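{- For any connected finite undirected graph $G$ which is not a clique, $CCW(G)\ge Udim(G)$.
   Context: A clique cover of $G$ is a set of pairwise vertex-disjoint cliques covering every vertex exactly once. For a clique cover $C$, the clique cover graph $G(C)$ has vertex set $C$, with $X,Y\in C$ adjacent iff some $x\in X$, $y\in Y$ are adjacent in $G$. The bandwidth $BW(H)$ is the minimum over linear orderings $v_0,\dots,v_{n-1}$ of $V(H)$ of $\max_{v_iv_j\in E(H)}|j-i|$. The clique cover width $CCW(G)$ is the minimum of $BW(G(C))$ over all clique covers $C$ of $G$. An incomparability graph is the complement of a comparability graph (the undirected graph underlying a strict partial order). A unit incomparability graph is a graph $H$ with $CCW(H)\le 1$. For graphs $H_1,\dots,H_d$ on a common vertex set $V$, their intersection is the graph on $V$ with edge set $\bigcap_i E(H_i)$. The unit incomparability dimension $Udim(G)$ is the smallest integer $d\ge1$ such that $G$ is the intersection of $d$ unit incomparability graphs on vertex set $V(G)$. -}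

module Defs where

open import Data.Nat using (ℕ; _≤_; ∣_-_∣)
open import Data.Fin using (Fin; toℕ)
open import Data.Product using (Σ; ∃; _×_; _,_)
open import Relation.Binary.PropositionalEquality using (_≡_; _≢_)
open import Relation.Nullary using (¬_)
open import Function.Bundles using (_↔_; Inverse)

record Graph (n : ℕ) : Set₁ where
  field
    Adj   : Fin n → Fin n → Set
    sym   : ∀ {u v} → Adj u v → Adj v u
    irrefl : ∀ {u} → ¬ Adj u u
open Graph public

data Reach {n : ℕ} (G : Graph n) : Fin n → Fin n → Set where
  here : ∀ {u} → Reach G u u
  step : ∀ {u v w} → Adj G u v → Reach G v w → Reach G u w

Connected : ∀ {n} → Graph n → Set
Connected {n} G = (u v : Fin n) → Reach G u v

IsClique : ∀ {n} → Graph n → Set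
IsClique {n} G = (u v : Fin n) → u ≢ v → Adj G u v

-- A clique cover: m nonempty cliques, indexed by Fin m; each vertex lies
-- in exactly one clique (given by the function cls).
record CliqueCover {n : ℕ} (G : Graph n) : Set where
  field
    m      : ℕ
    cls    : Fin n → Fin m
    nonempty : (X : Fin m) → ∃ λ u → cls u ≡ X
    clique : (u v : Fin n) → cls u ≡ cls v → u ≢ v → Adj G u v
open CliqueCover public

CoverAdj : ∀ {n} {G : Graph n} (C : CliqueCover G) → Fin (m C) → Fin (m C) → Set
CoverAdj {n} {G} C X Y =
  X ≢ Y × Σ (Fin n) λ x → Σ (Fin n) λ y → cls C x ≡ X × cls C y ≡ Y × Adj G x y

-- BW(H) ≤ w for a graph on Fin k given by adjacency relation R:
-- some linear ordering (position map pos : Fin k ↔ Fin k) has all edges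
-- stretched by at most w.
BandwidthLe : ∀ {k} → (Fin k → Fin k → Set) → ℕ → Set
BandwidthLe {k} R w =
  Σ (Fin k ↔ Fin k) λ pos →
    (X Y : Fin k) → R X Y →
      ∣ toℕ (Inverse.to pos X) - toℕ (Inverse.to pos Y) ∣ ≤ w

CCWLe : ∀ {n} → Graph n → ℕ → Set
CCWLe G w = Σ (CliqueCover G) λ C → BandwidthLe (CoverAdj C) w

UnitIncomparability : ∀ {n} → Graph n → Set
UnitIncomparability H = CCWLe H 1

IsIntersection : ∀ {n d} → Graph n → (Fin d → Graph n) → Set
IsIntersection {n} {d} G H =
  (u v : Fin n) → (Adj G u v → ((i : Fin d) → Adj (H i) u v))
                × (((i : Fin d) → Adj (H i) u v) → Adj G u v)

UdimLe : ∀ {n} → Graph n → ℕ → Set₁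
UdimLe {n} G k =
  Σ ℕ λ d → 1 ≤ d × d ≤ k ×
    Σ (Fin d → Graph n) λ H →
      ((i : Fin d) → UnitIncomparability (H i)) × IsIntersection G H

module Submission where

-- Place the cliques of a cover of bandwidth w at positions 0, …, m − 1. For
-- each shift r < w cut the positions into blocks of w consecutive ones, the
-- first block ending at w − 1 − r, and add to G every edge inside a block.
-- The blocks of cliques are cliques of the new graph, and an edge of G joins
-- positions at distance at most w, hence equal or consecutive blocks: the new
-- graph is a unit incomparability graph. A non-edge of G joins distinct
-- positions p < q, and the shift making p the last position of its block
-- separates them, so the w graphs intersect in G. Width 0 is impossible for
-- a connected graph that is not a clique, as every edge stays in one clique.

open import Defs hiding (sym)
open import Data.Nat using (ℕ; zero; suc; _+_; _*_; _∸_; _≤_; _<_; ∣_-_∣; pred; NonZero; >-nonZero⁻¹; z≤n; s≤s)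
open import Data.Nat.Properties hiding (_≟_)
open import Data.Nat.DivMod
open import Data.Nat.Divisibility using (∣-refl)
open import Algebra.Properties.CommutativeSemigroup +-commutativeSemigroup using (xy∙z≈xz∙y)
open import Data.Fin as Fin using (Fin; toℕ; fromℕ<; _≟_)
open import Data.Fin.Properties using (toℕ-injective; toℕ<n; toℕ-fromℕ<; nonZeroIndex)
open import Data.Product using (∃; _×_; _,_)
open import Data.Sum as Sum using (_⊎_; inj₁; inj₂; [_,_])
open import Function using (_∘_)
open import Function.Bundles using (Inverse; Injection)
open import Function.Properties.Inverse using (Inverse⇒Injection)
open import Function.Construct.Identity using (↔-id)
open import Relation.Binary.Definitions using (tri<; tri≈; tri>)
open import Relation.Binary.PropositionalEquality using (_≡_; _≢_; refl; sym; trans; cong; subst; module ≡-Reasoning)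
open import Relation.Nullary using (¬_; yes; no; contradiction)

module Blocks (s : ℕ) .{{_ : NonZero s}} where

  -- The index of the block of p when ℕ is cut into intervals [j s ∸ r, (j + 1) s ∸ r).
  block : ℕ → ℕ → ℕ
  block r p = (p + r) / s

  block-mono : ∀ r {p q} → p ≤ q → block r p ≤ block r q
  block-mono r p≤q = /-monoˡ-≤ s (+-monoˡ-≤ r p≤q)

  block-+s : ∀ r p → block r (p + s) ≡ suc (block r p)
  block-+s r p = begin
    (p + s + r) / s     ≡⟨ /-congˡ (xy∙z≈xz∙y p s r) ⟩
    (p + r + s) / s     ≡⟨ +-distrib-/-∣ʳ (p + r) ∣-refl ⟩
    (p + r) / s + s / s ≡⟨ cong ((p + r) / s +_) (n/n≡1 s) ⟩
    (p + r) / s + 1     ≡⟨ +-comm _ 1 ⟩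
    suc ((p + r) / s)   ∎
    where open ≡-Reasoning

  block-gap≤1 : ∀ r {p q} → p ≤ q → q ≤ p + s → ∣ block r p - block r q ∣ ≤ 1
  block-gap≤1 r {p} {q} p≤q q≤p+s = begin
    ∣ block r p - block r q ∣   ≡⟨ m≤n⇒∣m-n∣≡n∸m (block-mono r p≤q) ⟩
    block r q ∸ block r p       ≤⟨ ∸-monoˡ-≤ (block r p) (block-mono r q≤p+s) ⟩
    block r (p + s) ∸ block r p ≡⟨ cong (_∸ block r p) (block-+s r p) ⟩
    suc (block r p) ∸ block r p ≡⟨ m+n∸n≡m 1 (block r p) ⟩
    1                           ∎
    where open ≤-Reasoning

  block-∣-∣≤1 : ∀ r {p q} → ∣ p - q ∣ ≤ s → ∣ block r p - block r q ∣ ≤ 1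
  block-∣-∣≤1 r {p} {q} ∣p-q∣≤s with ≤-total p q
  ... | inj₁ p≤q = block-gap≤1 r p≤q (≤-trans (m≤n+∣n-m∣ q p) (+-monoʳ-≤ p ∣p-q∣≤s))
  ... | inj₂ q≤p = begin
    ∣ block r p - block r q ∣ ≡⟨ ∣-∣-comm (block r p) (block r q) ⟩
    ∣ block r q - block r p ∣ ≤⟨ block-gap≤1 r q≤p (≤-trans (m≤n+∣m-n∣ p q) (+-monoʳ-≤ q ∣p-q∣≤s)) ⟩
    1                         ∎
    where open ≤-Reasoning

  block-separates : ∀ {p q} → p < q → ∃ λ (r : Fin s) → block (toℕ r) p < block (toℕ r) q
  block-separates {p} {q} p<q =
    fromℕ< r<s , subst (λ r′ → block r′ p < block r′ q) (sym (toℕ-fromℕ< r<s)) (begin-strict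
    block r p             <⟨ m<n*o⇒m/o<n (≤-reflexive p-ends-block) ⟩
    suc (p / s)           ≡⟨ m*n/n≡m (suc (p / s)) s ⟨
    suc (p / s) * s / s   ≡⟨ /-congˡ p-ends-block ⟨
    block r (suc p)       ≤⟨ block-mono r p<q ⟩
    block r q             ∎)
    where
    open ≤-Reasoning
    p%s<s : p % s < s
    p%s<s = m%n<n p s
    r : ℕ
    r = s ∸ suc (p % s)
    r<s : r < s
    r<s = subst (r <_) (m∸n+n≡m p%s<s) (m<m+n r (s≤s z≤n))
    p-ends-block : suc p + r ≡ suc (p / s) * s
    p-ends-block = begin-equality
      suc p + r                   ≡⟨ cong (λ x → suc x + r) (m≡m%n+[m/n]*n p s) ⟩
      suc (p % s) + p / s * s + r ≡⟨ xy∙z≈xz∙y (suc (p % s)) (p / s * s) r ⟩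
      suc (p % s) + r + p / s * s ≡⟨ cong (_+ p / s * s) (m+[n∸m]≡n p%s<s) ⟩
      s + p / s * s               ∎

  block-section : ∀ {r} j → r < s → block r (j * s ∸ r) ≡ j
  block-section {r} zero    r<s = trans (cong (λ x → (x + r) / s) (0∸n≡0 r)) (m<n⇒m/n≡0 r<s)
  block-section {r} (suc j) r<s =
    trans (/-congˡ (m∸n+n≡m (≤-trans (<⇒≤ r<s) (m≤m+n s (j * s))))) (m*n/n≡m (suc j) s)

  block-attained : ∀ {r} M j → r < s → j ≤ block r M → ∃ λ p → p ≤ M × block r p ≡ j
  block-attained {r} M j r<s j≤ = j * s ∸ r , m≤n+o⇒m∸n≤o (j * s) r j*s≤r+M , block-section j r<s
    where
    j*s≤r+M : j * s ≤ r + M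
    j*s≤r+M = ≤-trans (*-monoˡ-≤ s j≤) (subst (block r M * s ≤_) (+-comm M r) (m/n*n≤m (M + r) s))

_∪_ : ∀ {n} → Graph n → Graph n → Graph n
G ∪ H = record
  { Adj    = λ u v → Adj G u v ⊎ Adj H u v
  ; sym    = Sum.map (Graph.sym G) (Graph.sym H)
  ; irrefl = [ irrefl G , irrefl H ]
  }

Fibres : ∀ {n} {A : Set} → (Fin n → A) → Graph n
Fibres f = record
  { Adj    = λ u v → u ≢ v × f u ≡ f v
  ; sym    = λ (u≢v , fu≡fv) → u≢v ∘ sym , sym fu≡fv
  ; irrefl = λ (u≢u , _) → u≢u refl
  }

Reach-respects : ∀ {n} {A : Set} {G : Graph n} (f : Fin n → A) →
  (∀ {u v} → Adj G u v → f u ≡ f v) → ∀ {u v} → Reach G u v → f u ≡ f v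
Reach-respects f respects here         = refl
Reach-respects f respects (step uv vw) = trans (respects uv) (Reach-respects f respects vw)

-- The content of CCWLe G w, with each vertex sent to the position of its
-- clique in the bandwidth ordering.
record Layout {n} (G : Graph n) (w : ℕ) : Set where
  field
    size           : ℕ
    pos            : Fin n → Fin size
    pos-surjective : ∀ j → ∃ λ u → pos u ≡ j
    samePos⇒Adj    : ∀ u v → pos u ≡ pos v → u ≢ v → Adj G u v
    Adj⇒close      : ∀ {u v} → Adj G u v → ∣ toℕ (pos u) - toℕ (pos v) ∣ ≤ w

module _ {n} {G : Graph n} where

  CCWLe⇒Layout : ∀ {w} → CCWLe G w → Layout G w
  CCWLe⇒Layout {w} (C , order , bw) = record
    { size           = m C
    ; pos            = to ∘ cls C
    ; pos-surjective = surjective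
    ; samePos⇒Adj    = λ u v → clique C u v ∘ injective
    ; Adj⇒close      = close
    }
    where
    open Inverse order using (to; from; inverseˡ)
    open Injection (Inverse⇒Injection order) using (injective)
    surjective : ∀ j → ∃ λ u → to (cls C u) ≡ j
    surjective j with nonempty C (from j)
    ... | u , cu≡from-j = u , inverseˡ cu≡from-j
    close : ∀ {u v} → Adj G u v → ∣ toℕ (to (cls C u)) - toℕ (to (cls C v)) ∣ ≤ w
    close {u} {v} uv with cls C u ≟ cls C v
    ... | yes cu≡cv = subst (_≤ w) (sym (m≡n⇒∣m-n∣≡0 (cong (toℕ ∘ to) cu≡cv))) z≤n
    ... | no  cu≢cv = bw (cls C u) (cls C v) (cu≢cv , u , v , refl , refl , uv)

  Layout⇒CCWLe : ∀ {w} → Layout G w → CCWLe G w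
  Layout⇒CCWLe L = cover , ↔-id _ , λ { _ _ (_ , u , v , refl , refl , uv) → Adj⇒close uv }
    where
    open Layout L
    cover : CliqueCover G
    cover = record { m = size ; cls = pos ; nonempty = pos-surjective ; clique = samePos⇒Adj }

  width0-connected⇒clique : Layout G 0 → Connected G → IsClique G
  width0-connected⇒clique L connected u v = samePos⇒Adj u v (Reach-respects pos samePos (connected u v))
    where
    open Layout L
    samePos : ∀ {u v} → Adj G u v → pos u ≡ pos v
    samePos uv = toℕ-injective (∣m-n∣≡0⇒m≡n (n≤0⇒n≡0 (Adj⇒close uv)))

module Shifted {n} {G : Graph n} {s : ℕ} .{{_ : NonZero s}} (L : Layout G s) where
  open Layout L
  open Blocks s

  P : Fin n → ℕ
  P u = toℕ (pos u)

  shifted : Fin s → Graph n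
  shifted r = G ∪ Fibres (block (toℕ r) ∘ P)

  P-attains : ∀ {p} → p < size → ∃ λ u → P u ≡ p
  P-attains p<size with pos-surjective (fromℕ< p<size)
  ... | u , pos-u≡ = u , trans (cong toℕ pos-u≡) (toℕ-fromℕ< p<size)

  -- The vertex u₀ is needed: on no vertices the single block would be an
  -- empty clique.
  shifted-layout : (r : Fin s) → Fin n → Layout (shifted r) 1
  shifted-layout r u₀ = record
    { size           = suc (block (toℕ r) (pred size))
    ; pos            = blockPos
    ; pos-surjective = surjective
    ; samePos⇒Adj    = λ u v e u≢v →
        inj₂ (u≢v , trans (sym (toℕ-blockPos u)) (trans (cong toℕ e) (toℕ-blockPos v)))
    ; Adj⇒close      = close
    }
    where
    blockPos<count : ∀ u → block (toℕ r) (P u) < suc (block (toℕ r) (pred size))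
    blockPos<count u = s≤s (block-mono (toℕ r) (<⇒≤pred (toℕ<n (pos u))))
    blockPos : Fin n → Fin (suc (block (toℕ r) (pred size)))
    blockPos u = fromℕ< (blockPos<count u)
    toℕ-blockPos : ∀ u → toℕ (blockPos u) ≡ block (toℕ r) (P u)
    toℕ-blockPos u = toℕ-fromℕ< (blockPos<count u)
    surjective : ∀ j → ∃ λ u → blockPos u ≡ j
    surjective j with block-attained (pred size) (toℕ j) (toℕ<n r) (≤-pred (toℕ<n j))
    ... | p , p≤pred-size , block-p≡j
        with P-attains (m≤pred[n]⇒suc[m]≤n {{nonZeroIndex (pos u₀)}} p≤pred-size)
    ... | u , Pu≡p =
        u , toℕ-injective (trans (toℕ-blockPos u) (trans (cong (block (toℕ r)) Pu≡p) block-p≡j))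
    close : ∀ {u v} → Adj (shifted r) u v → ∣ toℕ (blockPos u) - toℕ (blockPos v) ∣ ≤ 1
    close {u} {v} uv rewrite toℕ-blockPos u | toℕ-blockPos v with uv
    ... | inj₁ G-uv = block-∣-∣≤1 (toℕ r) (Adj⇒close G-uv)
    ... | inj₂ (_ , same-block) = subst (_≤ 1) (sym (m≡n⇒∣m-n∣≡0 same-block)) z≤n

  Adj-all-shifted⇒Adj : ∀ {u v} → P u < P v → (∀ r → Adj (shifted r) u v) → Adj G u v
  Adj-all-shifted⇒Adj {u} {v} Pu<Pv uv with block-separates Pu<Pv
  ... | r , separated with uv r
  ...   | inj₁ G-uv              = G-uv
  ...   | inj₂ (_ , same-block) = contradiction same-block (<⇒≢ separated)

  shifted-intersection : IsIntersection G shifted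
  shifted-intersection u v = (λ uv r → inj₁ uv) , all⇒Adj
    where
    all⇒Adj : (∀ r → Adj (shifted r) u v) → Adj G u v
    all⇒Adj uv with <-cmp (P u) (P v)
    ... | tri< Pu<Pv _ _ = Adj-all-shifted⇒Adj Pu<Pv uv
    ... | tri> _ _ Pv<Pu = Graph.sym G (Adj-all-shifted⇒Adj Pv<Pu (λ r → Graph.sym (shifted r) (uv r)))
    ... | tri≈ _ Pu≡Pv _ with u ≟ v
    ...   | no u≢v  = samePos⇒Adj u v (toℕ-injective Pu≡Pv) u≢v
    ...   | yes refl = contradiction (uv r₀) (irrefl (shifted r₀) {u})
      where
      r₀ : Fin s
      r₀ = fromℕ< (>-nonZero⁻¹ s)

CCWLe⇒UdimLe : ∀ {n} {G : Graph n} {w} .{{_ : NonZero w}} → Fin n → CCWLe G w → UdimLe G w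
CCWLe⇒UdimLe {w = w} u₀ ccw =
  w , >-nonZero⁻¹ w , ≤-refl , shifted , (λ r → Layout⇒CCWLe (shifted-layout r u₀)) , shifted-intersection
  where open Shifted (CCWLe⇒Layout ccw)

corollary2p1 : (n : ℕ) (G : Graph n) → Connected G → ¬ IsClique G →
    (w : ℕ) → CCWLe G w → UdimLe G w
corollary2p1 zero    G _         ¬clique _       _   = contradiction (λ ()) ¬clique
corollary2p1 (suc n) G connected ¬clique zero    ccw =
  contradiction (width0-connected⇒clique (CCWLe⇒Layout ccw) connected) ¬clique
corollary2p1 (suc n) G _         _       (suc w) ccw = CCWLe⇒UdimLe Fin.zero ccw
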